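{- Let $S$ be a sequent and $\phi$ a formula, and let $\pi\vdash S,\phi^\circ$ and $\tau\vdash S,\phi^\bullet$ be proofs in $(\mathsf{Grz}+\mathsf{cut})^\infty$ with no instance of (cut) in their main fragments. Then there is a proof of $S$ in $(\mathsf{Grz}+\mathsf{cut})^\infty$ with no instance of (cut) in its main fragment.
   Context: Formulas are built from propositional variables, $\bot$, $\to$, $\Box$. A sequent is a pair $(\Gamma,\Delta)$ of finite multisets of formulas; $S,\phi^\bullet$ means $S\cup(\{\phi\},\varnothing)$, $S,\phi^\circ$ means $S\cup(\varnothing,\{\phi\})$ (componentwise multiset union), similarly for multisets; $\Box\Pi=\{\Box\psi:\psi\in\Pi\}$. Rules (premises in order $0,1$): (Ax) conclusion $S,p^\bullet,p^\circ$, no premises; ($\bot^\bullet$) conclusion $S,\bot^\bullet$, no premises; ($\to^\bullet$) premises $S,\phi^\circ$ and $S,\psi^\bullet$, conclusion $S,(\phi\to\psi)^\bullet$; ($\to^\circ$) premise $S,\phi^\bullet,\psi^\circ$, conclusion $S,(\phi\to\psi)^\circ$; (Refl) premise $S,\phi^\bullet,\Box\phi^\bullet$, conclusion $S,\Box\phi^\bullet$; ($\Box$) premises $S,\Box\Pi^\bullet,\phi^\circ$ and $\Box\Pi^\bullet,\phi^\circ$, conclusion $S,\Box\Pi^\bullet,\Box\phi^\circ$; (cut) premises $S,\phi^\circ$ and $S,\phi^\bullet$, conclusion $S$. A proof in $(\mathsf{Grz}+\mathsf{cut})^\infty$ is a finitely branching, possibly infinite tree (nodes are words over $\mathbb{N}$,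 children of $w$ are $w0,w1,\dots$) labelled by a sequent and a rule, each node with its children forming an instance of its rule, such that every infinite branch passes infinitely often through a node that is the right premise (child 1) of a $(\Box)$-instance. $\pi\vdash S$ means the root sequent is $S$. The main fragment of $\pi$ is the set of nodes $w$ such that no node $u$ with $\epsilon\neq u\sqsubseteq w$ is the right premise of a $(\Box)$-instance; "no instance of (cut) in the main fragment" means no node in this set is labelled (cut). -}

module Defs where

open import Data.Nat using (ℕ; _<_; _≤_)
open import Data.List using (List; []; _∷_; _++_; map; upTo)
open import Data.List.Relation.Binary.Permutation.Propositional using (_↭_)
open import Data.Product using (_×_; ∃-syntax)
open import Relation.Binary.PropositionalEquality using (_≡_)
open import Relation.Nullary using (¬_)

data Formula : Set where
  var  : ℕ → Formula
  ⊥'   : Formula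
  _⇒_  : Formula → Formula → Formula
  □_   : Formula → Formula

infixr 20 _⇒_
infix 30 □_

-- Sequents: pairs of finite multisets, represented as lists compared
-- up to permutation (_≈ₛ_).

record Sequent : Set where
  constructor ⟨_∣_⟩
  field
    ant : List Formula
    suc : List Formula
open Sequent public

_≈ₛ_ : Sequent → Sequent → Set
S ≈ₛ T = (ant S ↭ ant T) × (suc S ↭ suc T)

∅ₛ : Sequent
∅ₛ = ⟨ [] ∣ [] ⟩

_,•_ : Sequent → Formula → Sequent
S ,• φ = ⟨ φ ∷ ant S ∣ suc S ⟩

_,∘_ : Sequent → Formula → Sequent
S ,∘ φ = ⟨ ant S ∣ φ ∷ suc S ⟩

_,□•_ : Sequent → List Formula → Sequent
S ,□• Π = ⟨ map □_ Π ++ ant S ∣ suc S ⟩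

infixl 10 _,•_ _,∘_ _,□•_

data Rule : Set where
  Ax botL impL impR Refl Box Cut : Rule

arity : Rule → ℕ
arity Ax   = 0
arity botL = 0
arity impL = 2
arity impR = 1
arity Refl = 1
arity Box  = 2
arity Cut  = 2

-- Inst r C Ps : conclusion C with premises Ps (in order 0,1) is an
-- instance of rule r (all sequents compared as multisets).
data Inst : Rule → Sequent → List Sequent → Set where
  ax   : ∀ {C} S p → C ≈ₛ (S ,• var p ,∘ var p) → Inst Ax C []
  botl : ∀ {C} S → C ≈ₛ (S ,• ⊥') → Inst botL C []
  impl : ∀ {C P₀ P₁} S φ ψ → C ≈ₛ (S ,• (φ ⇒ ψ)) →
           P₀ ≈ₛ (S ,∘ φ) → P₁ ≈ₛ (S ,• ψ) → Inst impL C (P₀ ∷ P₁ ∷ [])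
  impr : ∀ {C P₀} S φ ψ → C ≈ₛ (S ,∘ (φ ⇒ ψ)) →
           P₀ ≈ₛ (S ,• φ ,∘ ψ) → Inst impR C (P₀ ∷ [])
  refl : ∀ {C P₀} S φ → C ≈ₛ (S ,• □ φ) →
           P₀ ≈ₛ (S ,• φ ,• □ φ) → Inst Refl C (P₀ ∷ [])
  box  : ∀ {C P₀ P₁} S Π φ → C ≈ₛ (S ,□• Π ,∘ □ φ) →
           P₀ ≈ₛ (S ,□• Π ,∘ φ) → P₁ ≈ₛ (∅ₛ ,□• Π ,∘ φ) →
           Inst Box C (P₀ ∷ P₁ ∷ [])
  cut  : ∀ {C P₀ P₁} S φ → C ≈ₛ S →
           P₀ ≈ₛ (S ,∘ φ) → P₁ ≈ₛ (S ,• φ) → Inst Cut C (P₀ ∷ P₁ ∷ [])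

-- Trees.  Nodes are words over ℕ, stored REVERSED: the list
-- (i ∷ w) denotes the word w·i, i.e. the i-th child of w; [] is ε.

Node : Set
Node = List ℕ

-- A labelled, finitely branching (possibly infinite) tree: labels are
-- given on all words, the actual node set is determined by the arities
-- of the rules (w has exactly the children w0,…,w(k-1), k = arity).
record Tree : Set where
  field
    seqAt  : Node → Sequent
    ruleAt : Node → Rule

  data IsNode : Node → Set where
    root  : IsNode []
    child : ∀ {w i} → IsNode w → i < arity (ruleAt w) → IsNode (i ∷ w)

  pathNode : (ℕ → ℕ) → ℕ → Node
  pathNode β ℕ.zero    = []
  pathNode β (ℕ.suc n) = β n ∷ pathNode β n

  InfBranch : (ℕ → ℕ) → Set
  InfBranch β = ∀ n → IsNode (pathNode β n)

  -- the node at depth (m+1) of β is the right premise of a (□)-instance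
  RightBoxAt : (ℕ → ℕ) → ℕ → Set
  RightBoxAt β m = (ruleAt (pathNode β m) ≡ Box) × (β m ≡ 1)

  -- main fragment: no u ≠ ε with u ⊑ w is the right premise of a (□)
  data Main : Node → Set where
    main-root  : Main []
    main-child : ∀ {w i} → Main w → i < arity (ruleAt w) →
                 ¬ ((ruleAt w ≡ Box) × (i ≡ 1)) → Main (i ∷ w)

open Tree public

record IsProof (π : Tree) : Set where
  field
    locallyCorrect : ∀ w → IsNode π w →
      Inst (ruleAt π w) (seqAt π w)
           (map (λ i → seqAt π (i ∷ w)) (upTo (arity (ruleAt π w))))
    progressing : ∀ β → InfBranch π β →
      ∀ n → ∃[ m ] (n ≤ m × RightBoxAt π β m)

_⊢_ : Tree → Sequent → Set
π ⊢ S = IsProof π × (seqAt π [] ≈ₛ S)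

CutFreeMain : Tree → Set
CutFreeMain π = ∀ w → Main π w → ¬ (ruleAt π w ≡ Cut)

-- Cut elimination here is semantic. Every proof of (Grz + cut)^∞, cuts
-- included, is sound for finite Grz-models: from a point refuting the root
-- one climbs along refuted premises, moving to a strictly lower point only
-- at right premises of (□), so progressiveness would make the height of
-- the point decrease forever. Conversely, a terminating proof search on S
-- either builds a cut-free cyclic proof, whose unfolding proves S without
-- any cut, or a finite countermodel; its modal phase opens the goal
-- □Π•, χ∘ for each succedent □χ of a saturated sequent and closes a cycle
-- when a goal recurs with the same boxes. A countermodel to S would refute
-- the root of π or of τ, according to the value of φ.

module Submission where

open import Defs hiding (suc)
open Sequent using () renaming (suc to succedent)

open import Data.Bool using (Bool; true; false; _∧_; _∨_; not; if_then_else_)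
open import Data.Bool.Properties using (∨-zeroʳ; ∧-zeroʳ)
open import Data.Empty using (⊥; ⊥-elim)
open import Data.List using (List; []; _∷_; _++_; map; upTo; concatMap; deduplicate)
open import Data.List.Membership.Propositional using (_∈_; _∉_; find; lose)
open import Data.List.Membership.Propositional.Properties
  using (∈-++⁺ˡ; ∈-++⁺ʳ; ∈-++⁻; ∈-insert; ∈-∃++; ∈-map⁺; ∈-map⁻; ∈-deduplicate⁺; ∈-deduplicate⁻)
open import Data.List.Properties using (map-++; ++-identityʳ)
import Data.List.Relation.Binary.Permutation.Propositional as Perm
open Perm using (_↭_; ↭-refl; ↭-prep; ↭-swap; ↭-sym; ↭-trans; module PermutationReasoning)
open import Data.List.Relation.Binary.Permutation.Propositional.Properties
  using (All-resp-↭; ∈-resp-↭; shift; ++-comm) renaming (map⁺ to map⁺↭)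
open import Data.List.Relation.Binary.Subset.Propositional using (_⊆_)
open import Data.List.Relation.Unary.All as All using (All; []; _∷_; all?)
open import Data.List.Relation.Unary.All.Properties using (++⁺; ++⁻ˡ; map⁺; map⁻; ¬All⇒Any¬)
open import Data.List.Relation.Unary.Any using (Any; here; there; any?)
open import Data.List.Relation.Unary.Unique.Propositional using (Unique; []; _∷_)
open import Data.List.Relation.Unary.Unique.DecPropositional.Properties using (deduplicate-!)
import Data.Nat as ℕ
open import Data.Nat using (ℕ; zero; suc; _<_; _≤_; _≤′_; _+_; _⊔_; s≤s; z≤n; ≤′-refl; ≤′-step)
open import Data.Nat.ListAction using (sum)
open import Data.Nat.ListAction.Properties using (sum-++; sum-↭)
open import Data.Nat.Properties hiding (_≟_)
open import Data.Product as Product using (_×_; _,_; -,_; proj₁; proj₂; ∃; ∃-syntax)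
open import Data.Sum as Sum using (_⊎_; inj₁; inj₂; [_,_]′)
open import Data.Unit using (⊤; tt)
open import Function using (_∘_; id)
open import Relation.Binary.Definitions using (DecidableEquality)
open import Relation.Binary.PropositionalEquality
  using (_≡_; refl; sym; trans; cong; cong₂; subst; subst₂)
open import Relation.Nullary using (¬_; Dec; yes; no; does)
import Relation.Nullary.Decidable as Dec
open import Relation.Nullary.Decidable using (_×-dec_; toSum)

≈ₛ-refl : ∀ {S} → S ≈ₛ S
≈ₛ-refl = ↭-refl , ↭-refl

≈ₛ-reflexive : ∀ {S T} → S ≡ T → S ≈ₛ T
≈ₛ-reflexive refl = ≈ₛ-refl

≈ₛ-sym : ∀ {S T} → S ≈ₛ T → T ≈ₛ S
≈ₛ-sym (p , q) = ↭-sym p , ↭-sym q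

≈ₛ-trans : ∀ {S T U} → S ≈ₛ T → T ≈ₛ U → S ≈ₛ U
≈ₛ-trans (p , q) (p′ , q′) = ↭-trans p p′ , ↭-trans q q′

Inst-resp-≈ₛ : ∀ {r C C′ Ps} → C ≈ₛ C′ → Inst r C Ps → Inst r C′ Ps
Inst-resp-≈ₛ e (ax S p c)             = ax S p (≈ₛ-trans (≈ₛ-sym e) c)
Inst-resp-≈ₛ e (botl S c)             = botl S (≈ₛ-trans (≈ₛ-sym e) c)
Inst-resp-≈ₛ e (impl S φ ψ c p₀ p₁)   = impl S φ ψ (≈ₛ-trans (≈ₛ-sym e) c) p₀ p₁
Inst-resp-≈ₛ e (impr S φ ψ c p₀)      = impr S φ ψ (≈ₛ-trans (≈ₛ-sym e) c) p₀
Inst-resp-≈ₛ e (refl S φ c p₀)        = refl S φ (≈ₛ-trans (≈ₛ-sym e) c) p₀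
Inst-resp-≈ₛ e (box S Π φ c p₀ p₁)    = box S Π φ (≈ₛ-trans (≈ₛ-sym e) c) p₀ p₁
Inst-resp-≈ₛ e (cut S φ c p₀ p₁)      = cut S φ (≈ₛ-trans (≈ₛ-sym e) c) p₀ p₁

RightPremise : Rule → ℕ → Set
RightPremise r i = (r ≡ Box) × (i ≡ 1)

-- Soundness for finite Grz-models

-- □ is interpreted along the reflexive–transitive closure of the child
-- relation, so a model is a finite partial order: a Grz-frame.
data Model : Set where
  node : (ℕ → Bool) → List Model → Model

mutual
  eval : Model → Formula → Bool
  eval m           ⊥'      = false
  eval m           (a ⇒ b) = not (eval m a) ∨ eval m b
  eval (node v ms) (var p) = v p
  eval (node v ms) (□ a)   = eval (node v ms) a ∧ eval□ ms a

  eval□ : List Model → Formula → Bool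
  eval□ []       a = true
  eval□ (m ∷ ms) a = eval m (□ a) ∧ eval□ ms a

mutual
  height : Model → ℕ
  height (node v ms) = suc (heights ms)

  heights : List Model → ℕ
  heights []       = 0
  heights (m ∷ ms) = height m ⊔ heights ms

infix 4 _⊨_ _⊭_

_⊨_ _⊭_ : Model → Formula → Set
m ⊨ a = eval m a ≡ true
m ⊭ a = eval m a ≡ false

record Refutes (m : Model) (S : Sequent) : Set where
  constructor ⟪_,_⟫
  field
    antecedent : All (m ⊨_) (ant S)
    consequent : All (m ⊭_) (succedent S)

Refutes-resp-≈ₛ : ∀ {m S T} → S ≈ₛ T → Refutes m S → Refutes m T
Refutes-resp-≈ₛ (p , q) ⟪ a , s ⟫ = ⟪ All-resp-↭ p a , All-resp-↭ q s ⟫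

∧-trueˡ : ∀ {a b} → a ∧ b ≡ true → a ≡ true
∧-trueˡ {true} _ = refl

∧-trueʳ : ∀ {a b} → a ∧ b ≡ true → b ≡ true
∧-trueʳ {true} e = e

∧-false-trueˡ : ∀ {a b} → a ∧ b ≡ false → a ≡ true → b ≡ false
∧-false-trueˡ e refl = e

⇒-true : ∀ {a b} → not a ∨ b ≡ true → a ≡ false ⊎ b ≡ true
⇒-true {false} e = inj₁ refl
⇒-true {true}  e = inj₂ e

⇒-false : ∀ {a b} → not a ∨ b ≡ false → a ≡ true × b ≡ false
⇒-false {true} {false} e = refl , refl

⊨□⇒⊨ : ∀ m a → m ⊨ □ a → m ⊨ a
⊨□⇒⊨ (node v ms) a = ∧-trueˡ

⊨□-children : ∀ v ms {θ} → node v ms ⊨ □ θ → eval□ ms θ ≡ true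
⊨□-children v ms {θ} = ∧-trueʳ {eval (node v ms) θ}

⊭⇒⊭□ : ∀ m a → m ⊭ a → m ⊭ □ a
⊭⇒⊭□ (node v ms) a e rewrite e = refl

eval□-true : ∀ cs θ → (∀ {c} → c ∈ cs → c ⊨ □ θ) → eval□ cs θ ≡ true
eval□-true []       θ all⊨ = refl
eval□-true (c ∷ cs) θ all⊨ rewrite all⊨ (here refl) = eval□-true cs θ (all⊨ ∘ there)

eval□-false : ∀ cs θ {c} → c ∈ cs → c ⊭ □ θ → eval□ cs θ ≡ false
eval□-false (c ∷ cs) θ (here refl) c⊭ rewrite c⊭ = refl
eval□-false (c ∷ cs) θ (there c∈)  c⊭ rewrite eval□-false cs θ c∈ c⊭ = ∧-zeroʳ _

record Refuter (h : ℕ) (Boxed : Formula → Set) (φ : Formula) : Set where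
  field
    model    : Model
    bounded  : height model ≤ h
    refutes  : model ⊭ φ
    inherits : ∀ {θ} → Boxed θ → model ⊨ □ θ

Refuter-weaken : ∀ {h h′ B B′ φ} → h ≤ h′ → (∀ {θ} → B′ θ → B θ) → Refuter h B φ → Refuter h′ B′ φ
Refuter-weaken h≤h′ B′⇒B r = record
  { model = model ; bounded = ≤-trans bounded h≤h′ ; refutes = refutes ; inherits = λ b → inherits (B′⇒B b) }
  where open Refuter r

mutual
  refuterAt : ∀ m φ → m ⊭ □ φ → Refuter (height m) (λ θ → m ⊨ □ θ) φ
  refuterAt (node v ms) φ e with eval (node v ms) φ in eφ
  ... | false = record { model = node v ms ; bounded = ≤-refl ; refutes = eφ ; inherits = λ h → h }
  ... | true  = Refuter-weaken (n≤1+n _) (⊨□-children v ms) (refuterAmong ms φ e)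

  refuterAmong : ∀ ms φ → eval□ ms φ ≡ false → Refuter (heights ms) (λ θ → eval□ ms θ ≡ true) φ
  refuterAmong (m ∷ ms) φ e with eval m (□ φ) in e□
  ... | true  = Refuter-weaken (m≤n⊔m (height m) (heights ms)) ∧-trueʳ (refuterAmong ms φ e)
  ... | false = Refuter-weaken (m≤m⊔n (height m) (heights ms)) ∧-trueˡ (refuterAt m φ e□)

record RefutedPremise (r : Rule) (premise : ℕ → Sequent) (m : Model) : Set where
  field
    index      : ℕ
    valid      : index < arity r
    model      : Model
    refutes    : Refutes model (premise index)
    notHigher  : height model ≤ height m
    lowerAtBox : RightPremise r index → height model < height m

sameModel : ∀ {r g m} i → i < arity r → ¬ RightPremise r i → Refutes m (g i) → RefutedPremise r g m
sameModel {m = m} i i<r ¬box ref = record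
  { index = i ; valid = i<r ; model = m ; refutes = ref ; notHigher = ≤-refl
  ; lowerAtBox = λ box → ⊥-elim (¬box box) }

refutedPremise : ∀ {r C} g m → Inst r C (map g (upTo (arity r))) → Refutes m C → RefutedPremise r g m
refutedPremise g m (ax S p c) ref with Refutes-resp-≈ₛ c ref
... | ⟪ ⊨p ∷ _ , ⊭p ∷ _ ⟫ with () ← trans (sym ⊨p) ⊭p
refutedPremise g m (botl S c) ref with Refutes-resp-≈ₛ c ref
... | ⟪ () ∷ _ , _ ⟫
refutedPremise g m (impl S φ ψ c p₀ p₁) ref with Refutes-resp-≈ₛ c ref
... | ⟪ ⊨φ⇒ψ ∷ ⊨S , ⊭S ⟫ with ⇒-true ⊨φ⇒ψ
...   | inj₁ ⊭φ = sameModel 0 (s≤s z≤n) (λ ()) (Refutes-resp-≈ₛ (≈ₛ-sym p₀) ⟪ ⊨S , ⊭φ ∷ ⊭S ⟫)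
...   | inj₂ ⊨ψ = sameModel 1 (s≤s (s≤s z≤n)) (λ ()) (Refutes-resp-≈ₛ (≈ₛ-sym p₁) ⟪ ⊨ψ ∷ ⊨S , ⊭S ⟫)
refutedPremise g m (impr S φ ψ c p₀) ref with Refutes-resp-≈ₛ c ref
... | ⟪ ⊨S , ⊭φ⇒ψ ∷ ⊭S ⟫ with ⊨φ , ⊭ψ ← ⇒-false ⊭φ⇒ψ =
  sameModel 0 (s≤s z≤n) (λ ()) (Refutes-resp-≈ₛ (≈ₛ-sym p₀) ⟪ ⊨φ ∷ ⊨S , ⊭ψ ∷ ⊭S ⟫)
refutedPremise g m (refl S φ c p₀) ref with Refutes-resp-≈ₛ c ref
... | ⟪ ⊨□φ ∷ ⊨S , ⊭S ⟫ =
  sameModel 0 (s≤s z≤n) (λ ()) (Refutes-resp-≈ₛ (≈ₛ-sym p₀) ⟪ ⊨□φ ∷ ⊨□⇒⊨ m φ ⊨□φ ∷ ⊨S , ⊭S ⟫)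
refutedPremise g m (cut S φ c p₀ p₁) ref with Refutes-resp-≈ₛ c ref | eval m φ in eφ
... | ⟪ ⊨S , ⊭S ⟫ | false = sameModel 0 (s≤s z≤n) (λ ()) (Refutes-resp-≈ₛ (≈ₛ-sym p₀) ⟪ ⊨S , eφ ∷ ⊭S ⟫)
... | ⟪ ⊨S , ⊭S ⟫ | true  = sameModel 1 (s≤s (s≤s z≤n)) (λ ()) (Refutes-resp-≈ₛ (≈ₛ-sym p₁) ⟪ eφ ∷ ⊨S , ⊭S ⟫)
refutedPremise g (node v ms) (box S Π φ c p₀ p₁) ref with Refutes-resp-≈ₛ c ref | eval (node v ms) φ in eφ
... | ⟪ ⊨Π,S , ⊭□φ ∷ ⊭S ⟫ | false =
  sameModel 0 (s≤s z≤n) (λ ()) (Refutes-resp-≈ₛ (≈ₛ-sym p₀) ⟪ ⊨Π,S , eφ ∷ ⊭S ⟫)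
... | ⟪ ⊨Π,S , ⊭□φ ∷ ⊭S ⟫ | true = record
  { index = 1 ; valid = s≤s (s≤s z≤n) ; model = model
  ; refutes = Refutes-resp-≈ₛ (≈ₛ-sym p₁) ⟪ ++⁺ ⊨□Π [] , refutes ∷ [] ⟫
  ; notHigher = m≤n⇒m≤1+n bounded ; lowerAtBox = λ _ → s≤s bounded }
  where
    open Refuter (Refuter-weaken {B′ = λ θ → node v ms ⊨ □ θ} ≤-refl (⊨□-children v ms)
                                 (refuterAmong ms φ (∧-false-trueˡ ⊭□φ eφ)))
    ⊨□Π : All (model ⊨_) (map □_ Π)
    ⊨□Π = map⁺ (All.map inherits (map⁻ (++⁻ˡ (map □_ Π) ⊨Π,S)))

record RefutedNode (π : Tree) : Set where
  constructor refutedAt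
  field
    {position} : Node
    {model}    : Model
    isNode     : IsNode π position
    refutes    : Refutes model (seqAt π position)

module RefutedBranch {π : Tree} (proof : IsProof π) {m₀ : Model} (refutedRoot : Refutes m₀ (seqAt π [])) where
  open IsProof proof
  open RefutedNode

  step : (s : RefutedNode π) → RefutedPremise (ruleAt π (position s)) (λ i → seqAt π (i ∷ position s)) (model s)
  step s = refutedPremise _ _ (locallyCorrect (position s) (isNode s)) (refutes s)

  next : RefutedNode π → RefutedNode π
  next s = refutedAt (child (isNode s) (RefutedPremise.valid (step s))) (RefutedPremise.refutes (step s))

  state : ℕ → RefutedNode π
  state zero    = refutedAt root refutedRoot
  state (suc n) = next (state n)

  β : ℕ → ℕ
  β n = RefutedPremise.index (step (state n))

  h : ℕ → ℕ
  h n = height (model (state n))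

  pathNode-state : ∀ n → pathNode π β n ≡ position (state n)
  pathNode-state zero    = refl
  pathNode-state (suc n) = cong (β n ∷_) (pathNode-state n)

  β-infinite : InfBranch π β
  β-infinite n = subst (IsNode π) (sym (pathNode-state n)) (isNode (state n))

  h-antitone : ∀ {n k} → n ≤′ k → h k ≤ h n
  h-antitone ≤′-refl      = ≤-refl
  h-antitone (≤′-step {k} le) = ≤-trans (RefutedPremise.notHigher (step (state k))) (h-antitone le)

  h-drops : ∀ k → RightBoxAt π β k → h (suc k) < h k
  h-drops k (isBox , isRight) =
    RefutedPremise.lowerAtBox (step (state k))
      (subst (λ w → ruleAt π w ≡ Box) (pathNode-state k) isBox , isRight)

  descent : ∀ d → ∃[ n ] h n + d ≤ h 0
  descent zero = 0 , ≤-reflexive (+-identityʳ (h 0))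
  descent (suc d) with n , hn+d≤h0 ← descent d
                  with j , n≤j , boxAtj ← progressing β β-infinite n = suc j , (begin
    h (suc j) + suc d ≡⟨ +-suc (h (suc j)) d ⟩
    suc (h (suc j) + d) ≤⟨ +-monoˡ-≤ d (h-drops j boxAtj) ⟩
    h j + d             ≤⟨ +-monoˡ-≤ d (h-antitone (≤⇒≤′ n≤j)) ⟩
    h n + d             ≤⟨ hn+d≤h0 ⟩
    h 0                 ∎)
    where open ≤-Reasoning

  absurd : ⊥
  absurd with n , le ← descent (suc (h 0)) = n≮n (h 0) (m+n≤o⇒n≤o (h n) le)

sound : ∀ {π} → IsProof π → ∀ {m} → Refutes m (seqAt π []) → ⊥
sound proof refutedRoot = RefutedBranch.absurd proof refutedRoot

-- Cyclic proofs

-- Γ lists the right premises of the enclosing boxNew nodes; boxBack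
-- closes a cycle by taking one of them as its right premise.
data Cyclic (Γ : List Sequent) : Sequent → Set where
  leaf    : ∀ {r S} → Inst r S [] → Cyclic Γ S
  unary   : ∀ {r S T} → Inst r S (T ∷ []) → Cyclic Γ T → Cyclic Γ S
  impLeft : ∀ {S T₀ T₁} → Inst impL S (T₀ ∷ T₁ ∷ []) → Cyclic Γ T₀ → Cyclic Γ T₁ → Cyclic Γ S
  boxNew  : ∀ {S T₀ T₁} → Inst Box S (T₀ ∷ T₁ ∷ []) → Cyclic Γ T₀ → Cyclic (T₁ ∷ Γ) T₁ → Cyclic Γ S
  boxBack : ∀ {S T₀ T₁} → Inst Box S (T₀ ∷ T₁ ∷ []) → Cyclic Γ T₀ → T₁ ∈ Γ → Cyclic Γ S

Cyclic-resp-≈ₛ : ∀ {Γ S S′} → S ≈ₛ S′ → Cyclic Γ S → Cyclic Γ S′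
Cyclic-resp-≈ₛ e (leaf i)          = leaf (Inst-resp-≈ₛ e i)
Cyclic-resp-≈ₛ e (unary i c)       = unary (Inst-resp-≈ₛ e i) c
Cyclic-resp-≈ₛ e (impLeft i c d)   = impLeft (Inst-resp-≈ₛ e i) c d
Cyclic-resp-≈ₛ e (boxNew i c d)    = boxNew (Inst-resp-≈ₛ e i) c d
Cyclic-resp-≈ₛ e (boxBack i c T∈Γ) = boxBack (Inst-resp-≈ₛ e i) c T∈Γ

ruleOf : ∀ {Γ S} → Cyclic Γ S → Rule
ruleOf (leaf {r} _)    = r
ruleOf (unary {r} _ _) = r
ruleOf (impLeft _ _ _) = impL
ruleOf (boxNew _ _ _)  = Box
ruleOf (boxBack _ _ _) = Box

depth : ∀ {Γ S} → Cyclic Γ S → ℕ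
depth (leaf _)        = 0
depth (unary _ c)     = suc (depth c)
depth (impLeft _ c d) = suc (depth c ⊔ depth d)
depth (boxNew _ c _)  = suc (depth c)
depth (boxBack _ c _) = suc (depth c)

Companions : List Sequent → Set
Companions []      = ⊤
Companions (T ∷ Γ) = Cyclic (T ∷ Γ) T × Companions Γ

record Position : Set where
  constructor _▸_
  field
    {context}  : List Sequent
    {sequent}  : Sequent
    companions : Companions context
    proof      : Cyclic context sequent
open Position

resume : ∀ {T Γ} → Companions (T ∷ Γ) → Position
resume cs = cs ▸ proj₁ cs

companionOf : ∀ {T Γ} → Companions Γ → T ∈ Γ → ∃ λ Δ → Companions (T ∷ Δ)
companionOf {Γ = _ ∷ _} cs       (here refl) = -, cs
companionOf {Γ = _ ∷ _} (_ , cs) (there T∈Γ) = companionOf cs T∈Γ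

-- Indices beyond the arity of the rule are junk.
childAt : Position → ℕ → Position
childAt (cs ▸ leaf i)           _       = cs ▸ leaf i
childAt (cs ▸ unary _ c)        _       = cs ▸ c
childAt (cs ▸ impLeft _ c _)    zero    = cs ▸ c
childAt (cs ▸ impLeft _ _ d)    (suc _) = cs ▸ d
childAt (cs ▸ boxNew _ c _)     zero    = cs ▸ c
childAt (cs ▸ boxNew _ _ d)     (suc _) = resume (d , cs)
childAt (cs ▸ boxBack _ c _)    zero    = cs ▸ c
childAt (cs ▸ boxBack _ _ T∈Γ)  (suc _) = resume (proj₂ (companionOf cs T∈Γ))

positionAt : ∀ {S} → Cyclic [] S → Node → Position
positionAt c []      = tt ▸ c
positionAt c (i ∷ w) = childAt (positionAt c w) i

unfold : ∀ {S} → Cyclic [] S → Tree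
unfold c = record
  { seqAt  = λ w → sequent (positionAt c w)
  ; ruleAt = λ w → ruleOf (proof (positionAt c w)) }

childAt-correct : ∀ q → Inst (ruleOf (proof q)) (sequent q)
                             (map (λ i → sequent (childAt q i)) (upTo (arity (ruleOf (proof q)))))
childAt-correct (cs ▸ leaf i@(ax _ _ _))   = i
childAt-correct (cs ▸ leaf i@(botl _ _))   = i
childAt-correct (cs ▸ unary i@(impr _ _ _ _ _) _) = i
childAt-correct (cs ▸ unary i@(refl _ _ _ _) _)   = i
childAt-correct (cs ▸ impLeft i _ _)       = i
childAt-correct (cs ▸ boxNew i _ _)        = i
childAt-correct (cs ▸ boxBack i _ _)       = i

childAt-progress : ∀ q i → i < arity (ruleOf (proof q)) →
                   RightPremise (ruleOf (proof q)) i ⊎ depth (proof (childAt q i)) < depth (proof q)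
childAt-progress (cs ▸ leaf (ax _ _ _))        _ ()
childAt-progress (cs ▸ leaf (botl _ _))        _ ()
childAt-progress (cs ▸ unary _ _)              _ _ = inj₂ ≤-refl
childAt-progress (cs ▸ impLeft _ c d)          zero    _ = inj₂ (s≤s (m≤m⊔n (depth c) (depth d)))
childAt-progress (cs ▸ impLeft _ c d)          (suc _) _ = inj₂ (s≤s (m≤n⊔m (depth c) (depth d)))
childAt-progress (cs ▸ boxNew _ _ _)           zero    _ = inj₂ ≤-refl
childAt-progress (cs ▸ boxNew _ _ _)           1       _ = inj₁ (refl , refl)
childAt-progress (cs ▸ boxNew _ _ _)           (suc (suc _)) (s≤s (s≤s ()))
childAt-progress (cs ▸ boxBack _ _ _)          zero    _ = inj₂ ≤-refl
childAt-progress (cs ▸ boxBack _ _ _)          1       _ = inj₁ (refl , refl)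
childAt-progress (cs ▸ boxBack _ _ _)          (suc (suc _)) (s≤s (s≤s ()))

ruleOf≢Cut : ∀ {Γ S} (c : Cyclic Γ S) → ¬ ruleOf c ≡ Cut
ruleOf≢Cut (leaf (ax _ _ _))          ()
ruleOf≢Cut (leaf (botl _ _))          ()
ruleOf≢Cut (unary (impr _ _ _ _ _) _) ()
ruleOf≢Cut (unary (refl _ _ _ _) _)   ()
ruleOf≢Cut (impLeft _ _ _)            ()
ruleOf≢Cut (boxNew _ _ _)             ()
ruleOf≢Cut (boxBack _ _ _)            ()

module _ {S} (c : Cyclic [] S) where

  private
    depthOn : (ℕ → ℕ) → ℕ → ℕ
    depthOn β n = depth (proof (positionAt c (pathNode (unfold c) β n)))

  unfold-progressing : ∀ β → InfBranch (unfold c) β → ∀ n → ∃[ m ] (n ≤ m × RightBoxAt (unfold c) β m)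
  unfold-progressing β infinite n = go (depthOn β n) n ≤-refl
    where
      go : ∀ d n → depthOn β n ≤ d → ∃[ m ] (n ≤ m × RightBoxAt (unfold c) β m)
      go d n bound with infinite (suc n)
      ... | child _ valid with childAt-progress (positionAt c (pathNode (unfold c) β n)) (β n) valid
      ...   | inj₁ atBox = n , ≤-refl , atBox
      ...   | inj₂ lower with d
      ...     | zero = ⊥-elim (n≮0 (<-≤-trans lower bound))
      ...     | suc d′ with m , n+1≤m , atBox ← go d′ (suc n) (≤-pred (<-≤-trans lower bound)) =
                  m , <⇒≤ n+1≤m , atBox

  unfold-⊢ : unfold c ⊢ S
  unfold-⊢ = record
    { locallyCorrect = λ w _ → childAt-correct (positionAt c w)
    ; progressing    = unfold-progressing }
    , ≈ₛ-refl

  unfold-cutFree : CutFreeMain (unfold c)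
  unfold-cutFree w _ = ruleOf≢Cut (proof (positionAt c w))

-- Proof search

data Item : Set where
  L R : Formula → Item

formula : Item → Formula
formula (L f) = f
formula (R f) = f

L□ : Formula → Item
L□ θ = L (□ θ)

sequentOf : List Item → Sequent
sequentOf []         = ∅ₛ
sequentOf (L f ∷ xs) = sequentOf xs ,• f
sequentOf (R f ∷ xs) = sequentOf xs ,∘ f

sequentOf-↭ : ∀ {xs ys} → xs ↭ ys → sequentOf xs ≈ₛ sequentOf ys
sequentOf-↭ Perm.refl                = ≈ₛ-refl
sequentOf-↭ (Perm.prep (L f) p)      = Product.map₁ (↭-prep f) (sequentOf-↭ p)
sequentOf-↭ (Perm.prep (R f) p)      = Product.map₂ (↭-prep f) (sequentOf-↭ p)
sequentOf-↭ (Perm.swap (L f) (L g) p) = Product.map₁ (↭-swap f g) (sequentOf-↭ p)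
sequentOf-↭ (Perm.swap (L f) (R g) p) = Product.map (↭-prep f) (↭-prep g) (sequentOf-↭ p)
sequentOf-↭ (Perm.swap (R f) (L g) p) = Product.map (↭-prep g) (↭-prep f) (sequentOf-↭ p)
sequentOf-↭ (Perm.swap (R f) (R g) p) = Product.map₂ (↭-swap f g) (sequentOf-↭ p)
sequentOf-↭ (Perm.trans p q)          = ≈ₛ-trans (sequentOf-↭ p) (sequentOf-↭ q)

sequentOf-L□ : ∀ Π X → sequentOf (map L□ Π ++ X) ≡ (sequentOf X ,□• Π)
sequentOf-L□ []      X = refl
sequentOf-L□ (θ ∷ Π) X = cong (_,• □ θ) (sequentOf-L□ Π X)

sequentOf-LR : ∀ Γ Δ → sequentOf (map L Γ ++ map R Δ) ≡ ⟨ Γ ∣ Δ ⟩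
sequentOf-LR []      []      = refl
sequentOf-LR []      (f ∷ Δ) = cong (_,∘ f) (sequentOf-LR [] Δ)
sequentOf-LR (f ∷ Γ) Δ       = cong (_,• f) (sequentOf-LR Γ Δ)

infix 4 _≟_ _≟ᵢ_

_≟_ : DecidableEquality Formula
var p   ≟ var q   = Dec.map′ (cong var) var-injective (p ℕ.≟ q)
  where var-injective : ∀ {p q} → var p ≡ var q → p ≡ q
        var-injective refl = refl
⊥'      ≟ ⊥'      = yes refl
(a ⇒ b) ≟ (c ⇒ d) = Dec.map′ (λ (e , e′) → cong₂ _⇒_ e e′) ⇒-injective (a ≟ c ×-dec b ≟ d)
  where ⇒-injective : a ⇒ b ≡ c ⇒ d → a ≡ c × b ≡ d
        ⇒-injective refl = refl , refl
(□ a)   ≟ (□ b)   = Dec.map′ (cong □_) □-injective (a ≟ b)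
  where □-injective : □ a ≡ □ b → a ≡ b
        □-injective refl = refl
var _   ≟ ⊥'      = no λ ()
var _   ≟ (_ ⇒ _) = no λ ()
var _   ≟ (□ _)   = no λ ()
⊥'      ≟ var _   = no λ ()
⊥'      ≟ (_ ⇒ _) = no λ ()
⊥'      ≟ (□ _)   = no λ ()
(_ ⇒ _) ≟ var _   = no λ ()
(_ ⇒ _) ≟ ⊥'      = no λ ()
(_ ⇒ _) ≟ (□ _)   = no λ ()
(□ _)   ≟ var _   = no λ ()
(□ _)   ≟ ⊥'      = no λ ()
(□ _)   ≟ (_ ⇒ _) = no λ ()

_≟ᵢ_ : DecidableEquality Item
L a ≟ᵢ L b = Dec.map′ (cong L) (λ { refl → refl }) (a ≟ b)
R a ≟ᵢ R b = Dec.map′ (cong R) (λ { refl → refl }) (a ≟ b)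
L _ ≟ᵢ R _ = no λ ()
R _ ≟ᵢ L _ = no λ ()

open import Data.List.Membership.DecPropositional _≟_ using (_∈?_)
open import Data.List.Membership.DecPropositional _≟ᵢ_ using () renaming (_∈?_ to _∈ᵢ?_)

subformulas : Formula → List Formula
subformulas (var p) = var p ∷ []
subformulas ⊥'      = ⊥' ∷ []
subformulas (a ⇒ b) = (a ⇒ b) ∷ subformulas a ++ subformulas b
subformulas (□ a)   = □ a ∷ subformulas a

∈-subformulas : ∀ f → f ∈ subformulas f
∈-subformulas (var p) = here refl
∈-subformulas ⊥'      = here refl
∈-subformulas (a ⇒ b) = here refl
∈-subformulas (□ a)   = here refl

record Closed (U : List Formula) : Set where
  field
    ⇒-closed : ∀ {a b} → (a ⇒ b) ∈ U → a ∈ U × b ∈ U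
    □-closed : ∀ {a} → □ a ∈ U → a ∈ U
open Closed

Closed-[] : Closed []
Closed-[] = record { ⇒-closed = λ () ; □-closed = λ () }

Closed-++ : ∀ {X Y} → Closed X → Closed Y → Closed (X ++ Y)
Closed-++ {X} cX cY = record
  { ⇒-closed = λ ab∈ → [ Product.map ∈-++⁺ˡ ∈-++⁺ˡ ∘ ⇒-closed cX
                       , Product.map (∈-++⁺ʳ X) (∈-++⁺ʳ X) ∘ ⇒-closed cY ]′ (∈-++⁻ X ab∈)
  ; □-closed = λ □a∈ → [ ∈-++⁺ˡ ∘ □-closed cX , ∈-++⁺ʳ X ∘ □-closed cY ]′ (∈-++⁻ X □a∈) }

Closed-∷ : ∀ {f X} → Closed X → (∀ {a b} → f ≡ a ⇒ b → a ∈ X × b ∈ X) → (∀ {a} → f ≡ □ a → a ∈ X) →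
           Closed (f ∷ X)
Closed-∷ cX f⇒ f□ = record
  { ⇒-closed = λ { (here e)    → Product.map there there (f⇒ (sym e))
                 ; (there ab∈) → Product.map there there (⇒-closed cX ab∈) }
  ; □-closed = λ { (here e) → there (f□ (sym e)) ; (there □a∈) → there (□-closed cX □a∈) } }

Closed-subformulas : ∀ f → Closed (subformulas f)
Closed-subformulas (var p) = Closed-∷ Closed-[] (λ ()) (λ ())
Closed-subformulas ⊥'      = Closed-∷ Closed-[] (λ ()) (λ ())
Closed-subformulas (a ⇒ b) = Closed-∷ (Closed-++ (Closed-subformulas a) (Closed-subformulas b))
  (λ { refl → ∈-++⁺ˡ (∈-subformulas a) , ∈-++⁺ʳ (subformulas a) (∈-subformulas b) }) (λ ())
Closed-subformulas (□ a)   = Closed-∷ (Closed-subformulas a) (λ ()) (λ { refl → ∈-subformulas a })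

Closed-concatMap-subformulas : ∀ fs → Closed (concatMap subformulas fs)
Closed-concatMap-subformulas []       = Closed-[]
Closed-concatMap-subformulas (f ∷ fs) = Closed-++ (Closed-subformulas f) (Closed-concatMap-subformulas fs)

∈-concatMap-subformulas : ∀ {f fs} → f ∈ fs → f ∈ concatMap subformulas fs
∈-concatMap-subformulas {fs = g ∷ _}  (here refl) = ∈-++⁺ˡ (∈-subformulas g)
∈-concatMap-subformulas {fs = g ∷ _}  (there f∈)  = ∈-++⁺ʳ (subformulas g) (∈-concatMap-subformulas f∈)

missing : List Formula → List Formula → ℕ
missing []      X = 0
missing (u ∷ V) X = if does (u ∈? X) then missing V X else suc (missing V X)

missing-antitone : ∀ V {X Y} → X ⊆ Y → missing V Y ≤ missing V X
missing-antitone []      X⊆Y = z≤n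
missing-antitone (u ∷ V) {X} {Y} X⊆Y with u ∈? X | u ∈? Y
... | yes _   | yes _   = missing-antitone V X⊆Y
... | yes u∈X | no  u∉Y = ⊥-elim (u∉Y (X⊆Y u∈X))
... | no  _   | yes _   = m≤n⇒m≤1+n (missing-antitone V X⊆Y)
... | no  _   | no  _   = s≤s (missing-antitone V X⊆Y)

missing-< : ∀ V {X Y x} → X ⊆ Y → x ∈ V → x ∈ Y → x ∉ X → missing V Y < missing V X
missing-< (u ∷ V) {X} {Y} X⊆Y x∈V x∈Y x∉X with u ∈? X | u ∈? Y | x∈V
... | yes u∈X | no  u∉Y | _          = ⊥-elim (u∉Y (X⊆Y u∈X))
... | yes u∈X | yes _   | here refl  = ⊥-elim (x∉X u∈X)
... | yes _   | yes _   | there x∈V′ = missing-< V X⊆Y x∈V′ x∈Y x∉X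
... | no  _   | no  u∉Y | here refl  = ⊥-elim (u∉Y x∈Y)
... | no  _   | no  _   | there x∈V′ = s≤s (missing-< V X⊆Y x∈V′ x∈Y x∉X)
... | no  _   | yes _   | here refl  = s≤s (missing-antitone V X⊆Y)
... | no  _   | yes _   | there x∈V′ = m≤n⇒m≤1+n (missing-< V X⊆Y x∈V′ x∈Y x∉X)

-- □ adds two to the size, so that a succedent □χ waiting in the pool can
-- be charged strictly between the sizes of χ and □χ.
size : Formula → ℕ
size (var p) = 1
size ⊥'      = 1
size (a ⇒ b) = suc (size a + size b)
size (□ a)   = 2 + size a

boxWeight : Item → ℕ
boxWeight (R (□ χ)) = suc (size χ)
boxWeight _         = 0

measure : List Item → List Item → ℕ
measure P A = sum (map (size ∘ formula) A) + sum (map boxWeight P)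

boxWeight<size : ∀ x → boxWeight x < size (formula x)
boxWeight<size (L (var _))   = s≤s z≤n
boxWeight<size (L ⊥')        = s≤s z≤n
boxWeight<size (L (_ ⇒ _))   = s≤s z≤n
boxWeight<size (L (□ _))     = s≤s z≤n
boxWeight<size (R (var _))   = s≤s z≤n
boxWeight<size (R ⊥')        = s≤s z≤n
boxWeight<size (R (_ ⇒ _))   = s≤s z≤n
boxWeight<size (R (□ χ))     = ≤-refl

measure-park : ∀ x P A → measure (x ∷ P) A < measure P (x ∷ A)
measure-park x P A = begin-strict
  a + (boxWeight x + p)   ≡⟨ +-comm a _ ⟩
  (boxWeight x + p) + a   ≡⟨ +-assoc (boxWeight x) p a ⟩
  boxWeight x + (p + a)   <⟨ +-monoˡ-< (p + a) (boxWeight<size x) ⟩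
  size (formula x) + (p + a) ≡⟨ cong (size (formula x) +_) (+-comm p a) ⟩
  size (formula x) + (a + p) ≡⟨ +-assoc (size (formula x)) a p ⟨
  size (formula x) + a + p ∎
  where
    open ≤-Reasoning
    a = sum (map (size ∘ formula) A)
    p = sum (map boxWeight P)

measure-replace : ∀ P xs ys A → sum (map (size ∘ formula) xs) < sum (map (size ∘ formula) ys) →
                  measure P (xs ++ A) < measure P (ys ++ A)
measure-replace P xs ys A lt = +-monoˡ-< (sum (map boxWeight P)) (begin-strict
  sum (map (size ∘ formula) (xs ++ A))          ≡⟨ cong sum (map-++ (size ∘ formula) xs A) ⟩
  sum (map (size ∘ formula) xs ++ map _ A)       ≡⟨ sum-++ (map _ xs) (map _ A) ⟩
  sum (map (size ∘ formula) xs) + sum (map _ A)  <⟨ +-monoˡ-< (sum (map (size ∘ formula) A)) lt ⟩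
  sum (map (size ∘ formula) ys) + sum (map _ A)  ≡⟨ sum-++ (map _ ys) (map _ A) ⟨
  sum (map (size ∘ formula) ys ++ map _ A)       ≡⟨ cong sum (map-++ (size ∘ formula) ys A) ⟨
  sum (map (size ∘ formula) (ys ++ A))          ∎)
  where open ≤-Reasoning

measure-replace₁ : ∀ P x y A → size (formula x) < size (formula y) → measure P (x ∷ A) < measure P (y ∷ A)
measure-replace₁ P x y A lt = measure-replace P (x ∷ []) (y ∷ []) A (+-monoˡ-< 0 lt)

measure-impR : ∀ a b P A → measure P (L a ∷ R b ∷ A) < measure P (R (a ⇒ b) ∷ A)
measure-impR a b P A = measure-replace P (L a ∷ R b ∷ []) (R (a ⇒ b) ∷ []) A
  (subst₂ _<_ (cong (size a +_) (sym (+-identityʳ (size b)))) (sym (+-identityʳ (size (a ⇒ b)))) ≤-refl)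

measure-boxLeft : ∀ χ P P₁ → P ↭ R (□ χ) ∷ P₁ → measure P₁ (R χ ∷ []) < measure P []
measure-boxLeft χ P P₁ P↭ = begin-strict
  (size χ + 0) + sum (map boxWeight P₁) ≡⟨ cong (_+ sum (map boxWeight P₁)) (+-identityʳ (size χ)) ⟩
  size χ + sum (map boxWeight P₁)       <⟨ n<1+n _ ⟩
  sum (map boxWeight (R (□ χ) ∷ P₁))    ≡⟨ sum-↭ (map⁺↭ boxWeight P↭) ⟨
  sum (map boxWeight P)                 ∎
  where open ≤-Reasoning

-- x has been decomposed: what makes it true in a countermodel is in H.
Expanded : List Item → Item → Set
Expanded H (L (a ⇒ b)) = R a ∈ H ⊎ L b ∈ H
Expanded H (R (a ⇒ b)) = L a ∈ H × R b ∈ H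
Expanded H (R (□ χ))   = R χ ∈ H
Expanded H _           = ⊥

-- Items that may wait in the pool for the modal phase; a boxed antecedent
-- only once (Refl) has put its body into H.
Stored : List Item → Item → Set
Stored H (L (var _))  = ⊤
Stored H (L (□ θ))    = L θ ∈ H
Stored H (R (var _))  = ⊤
Stored H (R ⊥')       = ⊤
Stored H (R (□ _))    = ⊤
Stored H _            = ⊥

Clash : List Item → Item → Set
Clash P (R (var p)) = L (var p) ∈ P
Clash P _           = ⊥

clash? : ∀ P x → Dec (Clash P x)
clash? P (R (var p)) = L (var p) ∈ᵢ? P
clash? P (L _)       = no λ ()
clash? P (R ⊥')      = no λ ()
clash? P (R (_ ⇒ _)) = no λ ()
clash? P (R (□ _))   = no λ ()

Expanded-mono : ∀ {H H′} x → H ⊆ H′ → Expanded H x → Expanded H′ x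
Expanded-mono (L (a ⇒ b)) H⊆ = Sum.map H⊆ H⊆
Expanded-mono (R (a ⇒ b)) H⊆ = Product.map H⊆ H⊆
Expanded-mono (R (□ χ))   H⊆ = H⊆

Stored-mono : ∀ {H H′} x → H ⊆ H′ → Stored H x → Stored H′ x
Stored-mono (L (var _)) H⊆ s = tt
Stored-mono (L (□ θ))   H⊆ s = H⊆ s
Stored-mono (R (var _)) H⊆ s = tt
Stored-mono (R ⊥')      H⊆ s = tt
Stored-mono (R (□ _))   H⊆ s = tt

-- P is the pool, A the agenda and H every item met since the current
-- goal started; Π are the boxed antecedents the goal started with.
record Invariant (U Π : List Formula) (P A H : List Item) : Set where
  field
    inUniverse   : ∀ {x} → x ∈ P ++ A → formula x ∈ U
    boxesPresent : ∀ {θ} → θ ∈ Π → L□ θ ∈ P ++ A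
    saturated    : ∀ {x} → x ∈ H → x ∈ P ++ A ⊎ Expanded H x
    stored       : ∀ {x} → x ∈ P → Stored H x
open Invariant

-- Replacing the item h of P ++ A by the new items news.
Invariant-step : ∀ {U Π P A H P′ A′} h news →
  (∀ {y} → y ∈ P′ ++ A′ → y ∈ P ++ A ⊎ y ∈ news) → (∀ {y} → y ∈ news → formula y ∈ U) →
  (∀ {y} → y ∈ P ++ A → y ≡ h ⊎ y ∈ P′ ++ A′) → (h ∈ P′ ++ A′ ⊎ Expanded (news ++ H) h) →
  (∀ {θ} → h ≡ L□ θ → L□ θ ∈ P′ ++ A′) → news ⊆ P′ ++ A′ → (∀ {x} → x ∈ P′ → Stored (news ++ H) x) →
  Invariant U Π P A H → Invariant U Π P′ A′ (news ++ H)
Invariant-step {P = P} {A} {H} h news new⊆ newsU old⊆ h-kept h-box news⊆ stored′ inv = record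
  { inUniverse   = [ inUniverse inv , newsU ]′ ∘ new⊆
  ; boxesPresent = λ θ∈ → [ h-box ∘ sym , id ]′ (old⊆ (boxesPresent inv θ∈))
  ; saturated    = saturated′
  ; stored       = stored′ }
  where
    saturated′ : ∀ {x} → x ∈ news ++ H → x ∈ _ ⊎ Expanded (news ++ H) x
    saturated′ {x} x∈ with ∈-++⁻ news x∈
    ... | inj₁ x∈news = inj₁ (news⊆ x∈news)
    ... | inj₂ x∈H with saturated inv x∈H
    ...   | inj₂ expanded = inj₂ (Expanded-mono x (∈-++⁺ʳ news) expanded)
    ...   | inj₁ x∈PA with old⊆ x∈PA
    ...     | inj₁ refl = h-kept
    ...     | inj₂ x∈   = inj₁ x∈

∈-++-[] : ∀ {A : Set} {x : A} xs → x ∈ xs ++ [] → x ∈ xs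
∈-++-[] xs = subst (_ ∈_) (++-identityʳ xs)

module _ {U Π : List Formula} where

  Invariant-start : ∀ {A} → (∀ {x} → x ∈ A → formula x ∈ U) → (∀ {θ} → θ ∈ Π → L□ θ ∈ A) → Invariant U Π [] A A
  Invariant-start A⊆U Π⊆A = record { inUniverse = A⊆U ; boxesPresent = Π⊆A ; saturated = inj₁ ; stored = λ () }

  Invariant-park : ∀ h P A {H} → Invariant U Π P (h ∷ A) H → Stored H h → Invariant U Π (h ∷ P) A H
  Invariant-park h P A inv h-stored = Invariant-step h []
    (inj₁ ∘ ∈-resp-↭ (↭-sym (shift h P A))) (λ ())
    (inj₂ ∘ ∈-resp-↭ (shift h P A)) (inj₁ (here refl))
    (λ { refl → here refl }) (λ ())
    (λ { (here refl) → h-stored ; (there x∈P) → stored inv x∈P }) inv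

  Invariant-expand : ∀ h news P A {H} → Invariant U Π P (h ∷ A) H →
                     (∀ {y} → y ∈ news → formula y ∈ U) → Expanded (news ++ H) h → (∀ {θ} → ¬ h ≡ L□ θ) →
                     Invariant U Π P (news ++ A) (news ++ H)
  Invariant-expand h news P A inv newsU expanded not-□ = Invariant-step h news
    new⊆ newsU old⊆ (inj₂ expanded) (⊥-elim ∘ not-□) (∈-++⁺ʳ P ∘ ∈-++⁺ˡ)
    (Stored-mono _ (∈-++⁺ʳ news) ∘ stored inv) inv
    where
      new⊆ : ∀ {y} → y ∈ P ++ news ++ A → y ∈ P ++ h ∷ A ⊎ y ∈ news
      new⊆ y∈ with ∈-++⁻ P y∈
      ... | inj₁ y∈P = inj₁ (∈-++⁺ˡ y∈P)
      ... | inj₂ y∈ with ∈-++⁻ news y∈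
      ...   | inj₁ y∈news = inj₂ y∈news
      ...   | inj₂ y∈A    = inj₁ (∈-++⁺ʳ P (there y∈A))
      old⊆ : ∀ {y} → y ∈ P ++ h ∷ A → y ≡ h ⊎ y ∈ P ++ news ++ A
      old⊆ y∈ with ∈-resp-↭ (shift h P A) y∈
      ... | here y≡h = inj₁ y≡h
      ... | there y∈ = inj₂ ([ ∈-++⁺ˡ , ∈-++⁺ʳ P ∘ ∈-++⁺ʳ news ]′ (∈-++⁻ P y∈))

  Invariant-reflect : ∀ θ P A {H} → Invariant U Π P (L□ θ ∷ A) H → θ ∈ U →
                      Invariant U Π (L□ θ ∷ P) (L θ ∷ A) (L θ ∷ H)
  Invariant-reflect θ P A inv θ∈U = Invariant-step (L□ θ) (L θ ∷ [])
    new⊆ (λ { (here refl) → θ∈U }) old⊆ (inj₁ (here refl))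
    (λ { refl → here refl }) (λ { (here refl) → there (∈-insert P) })
    (λ { (here refl) → here refl ; (there x∈P) → Stored-mono _ there (stored inv x∈P) }) inv
    where
      new⊆ : ∀ {y} → y ∈ L□ θ ∷ P ++ L θ ∷ A → y ∈ P ++ L□ θ ∷ A ⊎ y ∈ L θ ∷ []
      new⊆ (here refl) = inj₁ (∈-insert P)
      new⊆ (there y∈) with ∈-resp-↭ (shift (L θ) P A) y∈
      ... | here y≡   = inj₂ (here y≡)
      ... | there y∈′ = inj₁ (∈-resp-↭ (↭-sym (shift (L□ θ) P A)) (there y∈′))
      old⊆ : ∀ {y} → y ∈ P ++ L□ θ ∷ A → y ≡ L□ θ ⊎ y ∈ L□ θ ∷ P ++ L θ ∷ A
      old⊆ y∈ with ∈-resp-↭ (shift (L□ θ) P A) y∈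
      ... | here y≡   = inj₁ y≡
      ... | there y∈′ = inj₂ (there (∈-resp-↭ (↭-sym (shift (L θ) P A)) (there y∈′)))

  Invariant-boxLeft : ∀ χ P P₁ {H} → Invariant U Π P [] H → P ↭ R (□ χ) ∷ P₁ → χ ∈ U →
                      Invariant U Π P₁ (R χ ∷ []) (R χ ∷ H)
  Invariant-boxLeft χ P P₁ inv P↭ χ∈U = Invariant-step (R (□ χ)) (R χ ∷ [])
    new⊆ (λ { (here refl) → χ∈U }) old⊆ (inj₂ (here refl)) (λ ()) (λ { (here refl) → ∈-++⁺ʳ P₁ (here refl) })
    (Stored-mono _ there ∘ stored inv ∘ ∈-resp-↭ (↭-sym P↭) ∘ there) inv
    where
      new⊆ : ∀ {y} → y ∈ P₁ ++ R χ ∷ [] → y ∈ P ++ [] ⊎ y ∈ R χ ∷ []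
      new⊆ y∈ = Sum.map₁ (∈-++⁺ˡ ∘ ∈-resp-↭ (↭-sym P↭) ∘ there) (∈-++⁻ P₁ y∈)
      old⊆ : ∀ {y} → y ∈ P ++ [] → y ≡ R (□ χ) ⊎ y ∈ P₁ ++ R χ ∷ []
      old⊆ y∈ with ∈-resp-↭ P↭ (∈-++-[] P y∈)
      ... | here y≡   = inj₁ y≡
      ... | there y∈′ = inj₂ (∈-++⁺ˡ y∈′)

RefutesItem : Model → Item → Set
RefutesItem t (L f) = t ⊨ f
RefutesItem t (R f) = t ⊭ f

RefutesAll : Model → List Item → Set
RefutesAll t H = ∀ {x} → x ∈ H → RefutesItem t x

module SaturatedLeaf (P H : List Item) (children : List Model)
  (saturated  : ∀ {x} → x ∈ H → x ∈ P ++ [] ⊎ Expanded H x)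
  (stored     : ∀ {x} → x ∈ P → Stored H x)
  (noAxiom    : ¬ Any (Clash P) P)
  (children⊨□ : ∀ {c θ} → c ∈ children → L□ θ ∈ P → c ⊨ □ θ)
  (children⊭□ : ∀ {χ} → R (□ χ) ∈ P → ∃ λ c → c ∈ children × c ⊭ □ χ) where

  countermodel : Model
  countermodel = node (λ p → does (L (var p) ∈ᵢ? P)) children

  private
    t = countermodel

    pooled : ∀ {x} → x ∈ P ++ [] → x ∈ P
    pooled = ∈-++-[] P

    truth : ∀ f → (L f ∈ H → t ⊨ f) × (R f ∈ H → t ⊭ f)
    truth (var p) = ⊨p , ⊭p
      where
        ⊨p : L (var p) ∈ H → t ⊨ var p
        ⊨p x∈ with saturated x∈
        ... | inj₁ x∈P = Dec.dec-true (L (var p) ∈ᵢ? P) (pooled x∈P)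
        ⊭p : R (var p) ∈ H → t ⊭ var p
        ⊭p x∈ with saturated x∈
        ... | inj₁ x∈P = Dec.dec-false (L (var p) ∈ᵢ? P) (noAxiom ∘ lose (pooled x∈P))
    truth ⊥' = ⊨⊥ , λ _ → refl
      where
        ⊨⊥ : L ⊥' ∈ H → t ⊨ ⊥'
        ⊨⊥ x∈ with saturated x∈
        ... | inj₁ x∈P = ⊥-elim (stored (pooled x∈P))
    truth (a ⇒ b) = ⊨a⇒b , ⊭a⇒b
      where
        ⊨a⇒b : L (a ⇒ b) ∈ H → t ⊨ a ⇒ b
        ⊨a⇒b x∈ with saturated x∈
        ... | inj₁ x∈P        = ⊥-elim (stored (pooled x∈P))
        ... | inj₂ (inj₁ Ra∈) rewrite proj₂ (truth a) Ra∈ = refl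
        ... | inj₂ (inj₂ Lb∈) rewrite proj₁ (truth b) Lb∈ = ∨-zeroʳ _
        ⊭a⇒b : R (a ⇒ b) ∈ H → t ⊭ a ⇒ b
        ⊭a⇒b x∈ with saturated x∈
        ... | inj₁ x∈P          = ⊥-elim (stored (pooled x∈P))
        ... | inj₂ (La∈ , Rb∈) rewrite proj₁ (truth a) La∈ | proj₂ (truth b) Rb∈ = refl
    truth (□ θ) = ⊨□θ , ⊭□θ
      where
        ⊨□θ : L (□ θ) ∈ H → t ⊨ □ θ
        ⊨□θ x∈ with saturated x∈
        ... | inj₁ x∈P rewrite proj₁ (truth θ) (stored (pooled x∈P))
                             | eval□-true children θ (λ c∈ → children⊨□ c∈ (pooled x∈P)) = refl
        ⊭□θ : R (□ θ) ∈ H → t ⊭ □ θ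
        ⊭□θ x∈ with saturated x∈
        ... | inj₂ Rθ∈ rewrite proj₂ (truth θ) Rθ∈ = refl
        ... | inj₁ x∈P with c , c∈ , c⊭ ← children⊭□ (pooled x∈P)
                       rewrite eval□-false children θ c∈ c⊭ = ∧-zeroʳ _

  countermodel-refutes : RefutesAll countermodel H
  countermodel-refutes {L f} = proj₁ (truth f)
  countermodel-refutes {R f} = proj₂ (truth f)

botL-inst : ∀ P A → Inst botL (sequentOf (P ++ L ⊥' ∷ A)) []
botL-inst P A = botl (sequentOf (P ++ A)) (sequentOf-↭ (shift (L ⊥') P A))

impL-inst : ∀ a b P A → Inst impL (sequentOf (P ++ L (a ⇒ b) ∷ A))
                                  (sequentOf (P ++ R a ∷ A) ∷ sequentOf (P ++ L b ∷ A) ∷ [])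
impL-inst a b P A = impl (sequentOf (P ++ A)) a b
  (sequentOf-↭ (shift (L (a ⇒ b)) P A)) (sequentOf-↭ (shift (R a) P A)) (sequentOf-↭ (shift (L b) P A))

impR-inst : ∀ a b P A → Inst impR (sequentOf (P ++ R (a ⇒ b) ∷ A)) (sequentOf (P ++ L a ∷ R b ∷ A) ∷ [])
impR-inst a b P A = impr (sequentOf (P ++ A)) a b (sequentOf-↭ (shift (R (a ⇒ b)) P A)) (sequentOf-↭ (begin
  P ++ L a ∷ R b ∷ A   ↭⟨ shift (L a) P (R b ∷ A) ⟩
  L a ∷ P ++ R b ∷ A   ↭⟨ ↭-prep (L a) (shift (R b) P A) ⟩
  L a ∷ R b ∷ P ++ A   ↭⟨ ↭-swap (L a) (R b) ↭-refl ⟩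
  R b ∷ L a ∷ P ++ A   ∎))
  where open PermutationReasoning

Refl-inst : ∀ θ P A → Inst Refl (sequentOf (P ++ L□ θ ∷ A)) (sequentOf (L□ θ ∷ P ++ L θ ∷ A) ∷ [])
Refl-inst θ P A = refl (sequentOf (P ++ A)) θ
  (sequentOf-↭ (shift (L□ θ) P A)) (sequentOf-↭ (↭-prep (L□ θ) (shift (L θ) P A)))

∈⇒↭-∷ : ∀ {A : Set} {x : A} {xs} → x ∈ xs → ∃ λ ys → xs ↭ x ∷ ys
∈⇒↭-∷ x∈ with ys , zs , refl ← ∈-∃++ x∈ = ys ++ zs , shift _ ys zs

Ax-inst : ∀ P {x} → x ∈ P → Clash P x → Inst Ax (sequentOf (P ++ [])) []
Ax-inst P {R (var p)} Rp∈ Lp∈ with P₁ , P↭ ← ∈⇒↭-∷ Rp∈ with ∈-resp-↭ P↭ Lp∈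
... | there Lp∈P₁ with P₂ , P₁↭ ← ∈⇒↭-∷ Lp∈P₁ = ax (sequentOf P₂) p (sequentOf-↭ (begin
  P ++ []                    ≡⟨ ++-identityʳ P ⟩
  P                          ↭⟨ P↭ ⟩
  R (var p) ∷ P₁             ↭⟨ ↭-prep (R (var p)) P₁↭ ⟩
  R (var p) ∷ L (var p) ∷ P₂ ∎))
  where open PermutationReasoning

L□-injective : ∀ {θ θ′} → L□ θ ≡ L□ θ′ → θ ≡ θ′
L□-injective refl = refl

split-L□ : ∀ Π P → Unique Π → (∀ {θ} → θ ∈ Π → L□ θ ∈ P) → ∃ λ P₂ → P ↭ map L□ Π ++ P₂
split-L□ []      P _             _   = P , ↭-refl
split-L□ (θ ∷ Π) P (θ∉Π ∷ Π-uniq) Π⊆P =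
  let Q , P↭ = ∈⇒↭-∷ (Π⊆P (here refl))
      P₂ , Q↭ = split-L□ Π Q Π-uniq (inRest P↭)
  in P₂ , ↭-trans P↭ (↭-prep (L□ θ) Q↭)
  where
    inRest : ∀ {Q} → P ↭ L□ θ ∷ Q → ∀ {θ′} → θ′ ∈ Π → L□ θ′ ∈ Q
    inRest P↭ θ′∈ with ∈-resp-↭ P↭ (Π⊆P (there θ′∈))
    ... | here e     = ⊥-elim (All.lookup θ∉Π θ′∈ (sym (L□-injective e)))
    ... | there L□∈Q = L□∈Q

goal : List Formula → Formula → Sequent
goal Π χ = sequentOf (map L□ Π ++ R χ ∷ [])

Box-inst : ∀ Π χ P P₁ → Unique Π → (∀ {θ} → θ ∈ Π → L□ θ ∈ P) → P ↭ R (□ χ) ∷ P₁ →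
           Inst Box (sequentOf (P ++ [])) (sequentOf (P₁ ++ R χ ∷ []) ∷ goal Π χ ∷ [])
Box-inst Π χ P P₁ Π-uniq Π⊆P P↭ = let P₂ , P₁↭ = split-L□ Π P₁ Π-uniq inP₁ in box (sequentOf P₂) Π χ
  (≈ₛ-trans (sequentOf-↭ (begin
     P ++ []                      ≡⟨ ++-identityʳ P ⟩
     P                            ↭⟨ P↭ ⟩
     R (□ χ) ∷ P₁                 ↭⟨ ↭-prep (R (□ χ)) P₁↭ ⟩
     R (□ χ) ∷ map L□ Π ++ P₂     ∎))
   (≈ₛ-reflexive (cong (_,∘ □ χ) (sequentOf-L□ Π P₂))))
  (≈ₛ-trans (sequentOf-↭ (begin
     P₁ ++ R χ ∷ []               ↭⟨ ++-comm P₁ (R χ ∷ []) ⟩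
     R χ ∷ P₁                     ↭⟨ ↭-prep (R χ) P₁↭ ⟩
     R χ ∷ map L□ Π ++ P₂         ∎))
   (≈ₛ-reflexive (cong (_,∘ χ) (sequentOf-L□ Π P₂))))
  (≈ₛ-reflexive (sequentOf-L□ Π (R χ ∷ [])))
  where
    open PermutationReasoning
    inP₁ : ∀ {θ} → θ ∈ Π → L□ θ ∈ P₁
    inP₁ θ∈ with ∈-resp-↭ P↭ (Π⊆P θ∈)
    ... | there L□∈P₁ = L□∈P₁

isL□ : ∀ x → (∃ λ θ → x ≡ L□ θ) ⊎ (∀ θ → ¬ x ≡ L□ θ)
isL□ (L (□ θ))   = inj₁ (θ , refl)
isL□ (L (var _)) = inj₂ λ _ ()
isL□ (L ⊥')      = inj₂ λ _ ()
isL□ (L (_ ⇒ _)) = inj₂ λ _ ()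
isL□ (R _)       = inj₂ λ _ ()

unboxed : List Item → List Formula
unboxed []       = []
unboxed (x ∷ xs) with isL□ x
... | inj₁ (θ , _) = θ ∷ unboxed xs
... | inj₂ _       = unboxed xs

∈-unboxed⁺ : ∀ {θ xs} → L□ θ ∈ xs → θ ∈ unboxed xs
∈-unboxed⁺ {xs = x ∷ xs} L□θ∈ with isL□ x | L□θ∈
... | inj₁ (_ , refl) | here e    = here (L□-injective e)
... | inj₁ _          | there L□∈ = there (∈-unboxed⁺ L□∈)
... | inj₂ not-□      | here e    = ⊥-elim (not-□ _ (sym e))
... | inj₂ _          | there L□∈ = ∈-unboxed⁺ L□∈

∈-unboxed⁻ : ∀ {θ} xs → θ ∈ unboxed xs → L□ θ ∈ xs
∈-unboxed⁻ (x ∷ xs) θ∈ with isL□ x | θ∈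
... | inj₁ (_ , refl) | here refl = here refl
... | inj₁ _          | there θ∈′ = there (∈-unboxed⁻ xs θ∈′)
... | inj₂ _          | θ∈′       = there (∈-unboxed⁻ xs θ∈′)

isR□ : ∀ x → (∃ λ χ → x ≡ R (□ χ)) ⊎ (∀ χ → ¬ x ≡ R (□ χ))
isR□ (R (□ χ))   = inj₁ (χ , refl)
isR□ (R (var _)) = inj₂ λ _ ()
isR□ (R ⊥')      = inj₂ λ _ ()
isR□ (R (_ ⇒ _)) = inj₂ λ _ ()
isR□ (L _)       = inj₂ λ _ ()

Refuted : List Item → Set
Refuted H = ∃ λ t → RefutesAll t H

Refuted-drop : ∀ news {H} → Refuted (news ++ H) → Refuted H
Refuted-drop news = Product.map₂ (_∘ ∈-++⁺ʳ news)

GoalRefuted : List Formula → Formula → Set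
GoalRefuted Π χ = ∃ λ t → (∀ {θ} → θ ∈ Π → t ⊨ □ θ) × t ⊭ χ

Outcome : List Sequent → List Item → List Item → List Item → Set
Outcome Γ P A H = Cyclic Γ (sequentOf (P ++ A)) ⊎ Refuted H

RightProof : List Sequent → Sequent → Set
RightProof Γ T = T ∈ Γ ⊎ Cyclic (T ∷ Γ) T

closeBox : ∀ {Γ} Π χ P P₁ → Unique Π → (∀ {θ} → θ ∈ Π → L□ θ ∈ P) → P ↭ R (□ χ) ∷ P₁ →
           Cyclic Γ (sequentOf (P₁ ++ R χ ∷ [])) → RightProof Γ (goal Π χ) → Cyclic Γ (sequentOf (P ++ []))
closeBox Π χ P P₁ Π-unique Π⊆P P↭ left (inj₁ back) = boxBack (Box-inst Π χ P P₁ Π-unique Π⊆P P↭) left back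
closeBox Π χ P P₁ Π-unique Π⊆P P↭ left (inj₂ new)  = boxNew (Box-inst Π χ P P₁ Π-unique Π⊆P P↭) left new

-- At a saturated leaf every succedent □χ is tried in turn: either both
-- premises of (□) are proved, or a refutation of the right premise
-- becomes a child of the countermodel.
module ModalPhase {Γ : List Sequent} {P H : List Item}
  (saturated : ∀ {x} → x ∈ H → x ∈ P ++ [] ⊎ Expanded H x)
  (stored    : ∀ {x} → x ∈ P → Stored H x)
  (noAxiom   : ¬ Any (Clash P) P)
  (Π : List Formula) (Π-unique : Unique Π)
  (Π⊆P : ∀ {θ} → θ ∈ Π → L□ θ ∈ P) (P⊆Π : ∀ {θ} → L□ θ ∈ P → θ ∈ Π)
  (left  : ∀ χ {P₁} → P ↭ R (□ χ) ∷ P₁ → Outcome Γ P₁ (R χ ∷ []) (R χ ∷ H))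
  (right : ∀ χ → R (□ χ) ∈ P → RightProof Γ (goal Π χ) ⊎ GoalRefuted Π χ) where

  BoxesHold : List Model → Set
  BoxesHold ms = ∀ {c θ} → c ∈ ms → L□ θ ∈ P → c ⊨ □ θ

  Covered : List Item → List Model → Set
  Covered Q ms = ∀ {χ} → R (□ χ) ∈ P → R (□ χ) ∈ Q ⊎ ∃ λ c → c ∈ ms × c ⊭ □ χ

  tryBoxes : ∀ Q → Q ⊆ P → ∀ ms → BoxesHold ms → Covered Q ms → Outcome Γ P [] H
  tryBoxes [] _ ms hold cover = inj₂ (countermodel , countermodel-refutes)
    where open SaturatedLeaf P H ms saturated stored noAxiom hold (λ R∈ → [ (λ ()) , id ]′ (cover R∈))
  tryBoxes (x ∷ Q) x∷Q⊆P ms hold cover with isR□ x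
  ... | inj₂ not-R□ = tryBoxes Q (x∷Q⊆P ∘ there) ms hold cover′
    where
      cover′ : Covered Q ms
      cover′ R∈ with cover R∈
      ... | inj₁ (here e)  = ⊥-elim (not-R□ _ (sym e))
      ... | inj₁ (there q) = inj₁ q
      ... | inj₂ refuted   = inj₂ refuted
  ... | inj₁ (χ , refl) with right χ (x∷Q⊆P (here refl))
  ...   | inj₁ rightProof with P₁ , P↭ ← ∈⇒↭-∷ (x∷Q⊆P (here refl)) =
    Sum.map (λ l → closeBox Π χ P P₁ Π-unique Π⊆P P↭ l rightProof) (Refuted-drop (R χ ∷ [])) (left χ P↭)
  ...   | inj₂ (t , t⊨□Π , t⊭χ) = tryBoxes Q (x∷Q⊆P ∘ there) (t ∷ ms) hold′ cover′
    where
      hold′ : BoxesHold (t ∷ ms)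
      hold′ (here refl) L□∈ = t⊨□Π (P⊆Π L□∈)
      hold′ (there c∈)  L□∈ = hold c∈ L□∈
      cover′ : Covered Q (t ∷ ms)
      cover′ R∈ with cover R∈
      ... | inj₁ (here refl)       = inj₂ (t , here refl , ⊭⇒⊭□ t χ t⊭χ)
      ... | inj₁ (there q)         = inj₁ q
      ... | inj₂ (c , c∈ , c⊭□)    = inj₂ (c , there c∈ , c⊭□)

  outcome : Outcome Γ P [] H
  outcome = tryBoxes P id [] (λ ()) inj₁

data Shape : Item → Set where
  passive : ∀ {x} → (∀ {H} → Stored H x) → Shape x
  ⊥•      : Shape (L ⊥')
  ⇒•      : ∀ a b → Shape (L (a ⇒ b))
  ⇒∘      : ∀ a b → Shape (R (a ⇒ b))
  □•      : ∀ θ → Shape (L□ θ)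

shape : ∀ x → Shape x
shape (L (var _)) = passive tt
shape (L ⊥')      = ⊥•
shape (L (a ⇒ b)) = ⇒• a b
shape (L (□ θ))   = □• θ
shape (R (var _)) = passive tt
shape (R ⊥')      = passive tt
shape (R (a ⇒ b)) = ⇒∘ a b
shape (R (□ _))   = passive tt

module Search (U : List Formula) (U-closed : Closed U) where

  data Level (Π : List Formula) (P : List Item) : Set where
    same  : (∀ {θ} → L□ θ ∈ P → θ ∈ Π) → Level Π P
    grown : ∀ Π′ → Unique Π′ → (∀ {θ} → θ ∈ Π′ → L□ θ ∈ P) → (∀ {θ} → L□ θ ∈ P → θ ∈ Π′) →
            missing U Π′ < missing U Π → Level Π P

  level : ∀ {Π P H} → Invariant U Π P [] H → Level Π P
  level {Π} {P} inv with all? (_∈? Π) (unboxed P)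
  ... | yes all∈Π = same (All.lookup all∈Π ∘ ∈-unboxed⁺)
  ... | no ¬all∈Π = grow (find (¬All⇒Any¬ (_∈? Π) (unboxed P) ¬all∈Π))
    where
      Π′ = deduplicate _≟_ (unboxed P)
      grow : (∃ λ θ → θ ∈ unboxed P × θ ∉ Π) → Level Π P
      grow (θ , θ∈ , θ∉Π) = grown Π′ (deduplicate-! _≟_ (unboxed P))
        (∈-unboxed⁻ P ∘ ∈-deduplicate⁻ _≟_ (unboxed P)) (∈-deduplicate⁺ _≟_ ∘ ∈-unboxed⁺)
        (missing-< U (λ θ′∈Π → ∈-deduplicate⁺ _≟_ (∈-unboxed⁺ (∈-++-[] P (boxesPresent inv θ′∈Π))))
                   (□-closed U-closed (inUniverse inv (∈-++⁺ˡ (∈-unboxed⁻ P θ∈))))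
                   (∈-deduplicate⁺ _≟_ θ∈) θ∉Π)

  pooled□∈U : ∀ {Π P A H χ} → Invariant U Π P A H → R (□ χ) ∈ P → χ ∈ U
  pooled□∈U inv R□χ∈ = □-closed U-closed (inUniverse inv (∈-++⁺ˡ R□χ∈))

  companionsOf : List Formula → List Formula → List Sequent → List Sequent
  companionsOf Π hist outer = map (goal Π) hist ++ outer

  -- Fuel: lexicographically, the formulas of U missing from Π, the goals
  -- of U not yet opened with these boxes, and the measure.
  mutual
    goalSearch : (o i : ℕ) (Π hist : List Formula) (outer : List Sequent) (χ : Formula) →
      Unique Π → (∀ {θ} → θ ∈ Π → □ θ ∈ U) → χ ∈ U → χ ∉ hist → missing U Π < o → missing U hist ≤ i →
      Cyclic (goal Π χ ∷ companionsOf Π hist outer) (goal Π χ) ⊎ GoalRefuted Π χ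
    goalSearch o i Π hist outer χ Π-unique □Π⊆U χ∈U χ∉hist o-bound i-bound =
      Sum.map₂ goalRefuted (expand o i (suc (measure [] A₀)) Π (χ ∷ hist) outer [] A₀ A₀ Π-unique o-bound
        (<-≤-trans (missing-< U there χ∈U (here refl) χ∉hist) i-bound) ≤-refl
        (Invariant-start A₀⊆U (∈-++⁺ˡ ∘ ∈-map⁺ L□)))
      where
        A₀ = map L□ Π ++ R χ ∷ []
        A₀⊆U : ∀ {x} → x ∈ A₀ → formula x ∈ U
        A₀⊆U x∈ with ∈-++⁻ (map L□ Π) x∈
        ... | inj₁ x∈□Π with _ , θ∈ , refl ← ∈-map⁻ L□ x∈□Π = □Π⊆U θ∈
        ... | inj₂ (here refl) = χ∈U
        goalRefuted : Refuted A₀ → GoalRefuted Π χ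
        goalRefuted (t , refutes) = t , refutes ∘ ∈-++⁺ˡ ∘ ∈-map⁺ L□ , refutes (∈-++⁺ʳ (map L□ Π) (here refl))

    expand : (o i m : ℕ) (Π hist : List Formula) (outer : List Sequent) (P A H : List Item) →
      Unique Π → missing U Π < o → missing U hist < i → measure P A < m → Invariant U Π P A H →
      Outcome (companionsOf Π hist outer) P A H
    expand o i m Π hist outer P [] H Π-unique o-bound i-bound m-bound inv =
      leafSearch o i m Π hist outer P H Π-unique o-bound i-bound m-bound inv
    expand o i (suc m) Π hist outer P (x ∷ A) H Π-unique o-bound i-bound m-bound inv with shape x
    ... | passive x-stored = Sum.map₁ (Cyclic-resp-≈ₛ (sequentOf-↭ (↭-sym (shift x P A))))
      (expand o i m Π hist outer (x ∷ P) A H Π-unique o-bound i-bound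
              (<-≤-trans (measure-park x P A) (≤-pred m-bound)) (Invariant-park x P A inv x-stored))
    ... | ⊥• = inj₁ (leaf (botL-inst P A))
    ... | □• θ = Sum.map (unary (Refl-inst θ P A)) (Refuted-drop (L θ ∷ []))
      (expand o i m Π hist outer (L□ θ ∷ P) (L θ ∷ A) (L θ ∷ H) Π-unique o-bound i-bound
              (<-≤-trans (measure-replace₁ P (L θ) (L□ θ) A (m<n⇒m<1+n (n<1+n _))) (≤-pred m-bound))
              (Invariant-reflect θ P A inv (□-closed U-closed x∈U)))
      where x∈U = inUniverse inv (∈-insert P)
    ... | ⇒∘ a b = Sum.map (unary (impR-inst a b P A)) (Refuted-drop (L a ∷ R b ∷ []))
      (expand o i m Π hist outer P (L a ∷ R b ∷ A) (L a ∷ R b ∷ H) Π-unique o-bound i-bound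
              (<-≤-trans (measure-impR a b P A) (≤-pred m-bound))
              (Invariant-expand (R (a ⇒ b)) (L a ∷ R b ∷ []) P A inv
                 (λ { (here refl) → a∈U ; (there (here refl)) → b∈U }) (here refl , there (here refl)) λ ()))
      where a∈U,b∈U = ⇒-closed U-closed (inUniverse inv (∈-insert P))
            a∈U = proj₁ a∈U,b∈U
            b∈U = proj₂ a∈U,b∈U
    ... | ⇒• a b =
      [ (λ c₀ → Sum.map (impLeft (impL-inst a b P A) c₀) (Refuted-drop (L b ∷ []))
          (expand o i m Π hist outer P (L b ∷ A) (L b ∷ H) Π-unique o-bound i-bound
                  (<-≤-trans (measure-replace₁ P (L b) (L (a ⇒ b)) A (s≤s (m≤n+m _ _))) (≤-pred m-bound))
                  (Invariant-expand (L (a ⇒ b)) (L b ∷ []) P A inv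
                     (λ { (here refl) → b∈U }) (inj₂ (here refl)) λ ())))
      , inj₂ ∘ Refuted-drop (R a ∷ []) ]′
      (expand o i m Π hist outer P (R a ∷ A) (R a ∷ H) Π-unique o-bound i-bound
              (<-≤-trans (measure-replace₁ P (R a) (L (a ⇒ b)) A (s≤s (m≤m+n _ _))) (≤-pred m-bound))
              (Invariant-expand (L (a ⇒ b)) (R a ∷ []) P A inv
                 (λ { (here refl) → a∈U }) (inj₁ (here refl)) λ ()))
      where a∈U,b∈U = ⇒-closed U-closed (inUniverse inv (∈-insert P))
            a∈U = proj₁ a∈U,b∈U
            b∈U = proj₂ a∈U,b∈U

    leafSearch : (o i m : ℕ) (Π hist : List Formula) (outer : List Sequent) (P H : List Item) →
      Unique Π → missing U Π < o → missing U hist < i → measure P [] < m → Invariant U Π P [] H →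
      Outcome (companionsOf Π hist outer) P [] H
    leafSearch o i m Π hist outer P H Π-unique o-bound i-bound m-bound inv with any? (clash? P) P
    ... | yes clash with _ , x∈P , x-clash ← find clash = inj₁ (leaf (Ax-inst P x∈P x-clash))
    ... | no noAxiom =
      modalSearch o i m Π hist outer P H Π-unique o-bound i-bound m-bound inv noAxiom (level inv)

    modalSearch : (o i m : ℕ) (Π hist : List Formula) (outer : List Sequent) (P H : List Item) →
      Unique Π → missing U Π < o → missing U hist < i → measure P [] < m → Invariant U Π P [] H →
      ¬ Any (Clash P) P → Level Π P → Outcome (companionsOf Π hist outer) P [] H
    modalSearch (suc o) (suc i) (suc m) Π hist outer P H Π-unique o-bound i-bound m-bound inv noAxiom
                (same P⊆Π) =
      ModalPhase.outcome (saturated inv) (stored inv) noAxiom Π Π-unique (∈-++-[] P ∘ boxesPresent inv) P⊆Π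
        (leftPremise (suc o) (suc i) m Π hist outer P H Π-unique o-bound i-bound m-bound inv)
        (λ χ R□χ∈ → [ (λ χ∈hist → inj₁ (inj₁ (∈-++⁺ˡ (∈-map⁺ (goal Π) χ∈hist))))
                    , (λ χ∉hist → Sum.map₁ inj₂ (goalSearch (suc o) i Π hist outer χ Π-unique
                                     (inUniverse inv ∘ boxesPresent inv) (pooled□∈U inv R□χ∈) χ∉hist
                                     o-bound (≤-pred i-bound)))
                    ]′ (toSum (χ ∈? hist)))
    modalSearch (suc o) (suc i) (suc m) Π hist outer P H Π-unique o-bound i-bound m-bound inv noAxiom
                (grown Π′ Π′-unique Π′⊆P P⊆Π′ fewer-missing) =
      ModalPhase.outcome (saturated inv) (stored inv) noAxiom Π′ Π′-unique Π′⊆P P⊆Π′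
        (leftPremise (suc o) (suc i) m Π hist outer P H Π-unique o-bound i-bound m-bound inv)
        (λ χ R□χ∈ → Sum.map₁ inj₂ (goalSearch o (missing U []) Π′ [] (companionsOf Π hist outer) χ Π′-unique
           (inUniverse inv ∘ ∈-++⁺ˡ ∘ Π′⊆P) (pooled□∈U inv R□χ∈) (λ ())
           (<-≤-trans fewer-missing (≤-pred o-bound)) ≤-refl))

    leftPremise : (o i m : ℕ) (Π hist : List Formula) (outer : List Sequent) (P H : List Item) →
      Unique Π → missing U Π < o → missing U hist < i → measure P [] < suc m → Invariant U Π P [] H →
      ∀ χ {P₁} → P ↭ R (□ χ) ∷ P₁ → Outcome (companionsOf Π hist outer) P₁ (R χ ∷ []) (R χ ∷ H)
    leftPremise o i m Π hist outer P H Π-unique o-bound i-bound m-bound inv χ {P₁} P↭ =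
      expand o i m Π hist outer P₁ (R χ ∷ []) (R χ ∷ H) Π-unique o-bound i-bound
        (<-≤-trans (measure-boxLeft χ P P₁ P↭) (≤-pred m-bound))
        (Invariant-boxLeft χ P P₁ inv P↭ (pooled□∈U inv (∈-resp-↭ (↭-sym P↭) (here refl))))

decide : (S : Sequent) → Cyclic [] S ⊎ ∃ λ t → Refutes t S
decide S = Sum.map (Cyclic-resp-≈ₛ (≈ₛ-reflexive (sequentOf-LR (ant S) (succedent S)))) refutation
  (Search.expand U (Closed-concatMap-subformulas (ant S ++ succedent S))
     (suc (missing U [])) (suc (missing U [])) (suc (measure [] A₀)) [] [] [] [] A₀ A₀ []
     (n<1+n _) (n<1+n _) (n<1+n _) (Invariant-start A₀⊆U λ ()))
  where
    U  = concatMap subformulas (ant S ++ succedent S)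
    A₀ = map L (ant S) ++ map R (succedent S)
    A₀⊆U : ∀ {x} → x ∈ A₀ → formula x ∈ U
    A₀⊆U x∈ with ∈-++⁻ (map L (ant S)) x∈
    ... | inj₁ x∈L with _ , f∈ , refl ← ∈-map⁻ L x∈L = ∈-concatMap-subformulas (∈-++⁺ˡ f∈)
    ... | inj₂ x∈R with _ , f∈ , refl ← ∈-map⁻ R x∈R = ∈-concatMap-subformulas (∈-++⁺ʳ (ant S) f∈)
    refutation : Refuted A₀ → ∃ λ t → Refutes t S
    refutation (t , refutes) =
      t , ⟪ All.tabulate (refutes ∘ ∈-++⁺ˡ ∘ ∈-map⁺ L)
          , All.tabulate (refutes ∘ ∈-++⁺ʳ (map L (ant S)) ∘ ∈-map⁺ R) ⟫

lemma4p4 : (S : Sequent) (φ : Formula) (π τ : Tree) →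
    π ⊢ (S ,∘ φ) → CutFreeMain π →
    τ ⊢ (S ,• φ) → CutFreeMain τ →
    ∃[ ρ ] (ρ ⊢ S × CutFreeMain ρ)
lemma4p4 S φ π τ (π-proof , π-root) _ (τ-proof , τ-root) _ with decide S
... | inj₁ c = unfold c , unfold-⊢ c , unfold-cutFree c
... | inj₂ (t , ⟪ ⊨Γ , ⊭Δ ⟫) with eval t φ in eφ
...   | false = ⊥-elim (sound π-proof (Refutes-resp-≈ₛ (≈ₛ-sym π-root) ⟪ ⊨Γ , eφ ∷ ⊭Δ ⟫))
...   | true  = ⊥-elim (sound τ-proof (Refutes-resp-≈ₛ (≈ₛ-sym τ-root) ⟪ eφ ∷ ⊨Γ , ⊭Δ ⟫))
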